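{- For all $n,k\ge0$, the number of involutions $\pi\in\mathbf I_n(3412)$ with exactly $k$ ascents equals the number of Motzkin paths of length $n$ with exactly $k$ weak valleys.
   Context: $\mathbf I_n(3412)$ is the set of involutions of $\{1,\dots,n\}$ with no subsequence order-isomorphic to $3412$. An ascent of $\pi$ is a position $i$ with $\pi_i<\pi_{i+1}$. A Motzkin path of length $n$ is a word over $\{U,D,H\}$ (steps $(1,1),(1,-1),(1,0)$) from $(0,0)$ to $(n,0)$ never going below the $x$-axis. A weak valley is an occurrence of one of the consecutive two-letter subwords $HH$, $HU$, $DH$, $DU$. -}

module Defs where

open import Data.Bool using (Bool; true; false; _∧_; _∨_; not; if_then_else_)
open import Data.Nat using (ℕ; zero; suc; _+_; _<ᵇ_; _≡ᵇ_)
open import Data.Fin using (Fin; toℕ)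
open import Data.Fin.Properties using (_≟_)
open import Data.List using (List; []; _∷_; [_]; map; concatMap; allFin; length; filterᵇ)
open import Data.Vec using (Vec; lookup; toList) renaming ([] to []ᵛ; _∷_ to _∷ᵛ_)
open import Relation.Nullary.Decidable using (⌊_⌋)
open import Data.Bool.ListAction using (all; any)

allVecs : (n m : ℕ) → List (Vec (Fin m) n)
allVecs zero    m = [ []ᵛ ]
allVecs (suc n) m = concatMap (λ x → map (x ∷ᵛ_) (allVecs n m)) (allFin m)

-- A word w ∈ Vec (Fin n) n is read as the map i ↦ w_i on {0..n-1}
-- (0-indexed version of {1..n}).  It is an involution iff w(w(i)) = i for all i;
-- this also forces it to be a permutation.
isInvolution : {n : ℕ} → Vec (Fin n) n → Bool
isInvolution {n} w = all (λ i → ⌊ lookup w (lookup w i) ≟ i ⌋) (allFin n)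

contains3412 : {n : ℕ} → Vec (Fin n) n → Bool
contains3412 {n} w =
  any (λ i → any (λ j → any (λ k → any (λ l →
       (toℕ i <ᵇ toℕ j) ∧ (toℕ j <ᵇ toℕ k) ∧ (toℕ k <ᵇ toℕ l) ∧
       (v k <ᵇ v l) ∧ (v l <ᵇ v i) ∧ (v i <ᵇ v j))
     (allFin n)) (allFin n)) (allFin n)) (allFin n)
  where
  v : Fin n → ℕ
  v i = toℕ (lookup w i)

ascentsList : List ℕ → ℕ
ascentsList (x ∷ y ∷ xs) = (if x <ᵇ y then 1 else 0) + ascentsList (y ∷ xs)
ascentsList _ = 0

ascents : {n : ℕ} → Vec (Fin n) n → ℕ
ascents w = ascentsList (map toℕ (toList w))

numInvolutions3412 : (n k : ℕ) → ℕ
numInvolutions3412 n k =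
  length (filterᵇ (λ w → isInvolution w ∧ not (contains3412 w) ∧ (ascents w ≡ᵇ k))
                  (allVecs n n))

data Step : Set where
  U D H : Step

allSteps : List Step
allSteps = U ∷ D ∷ H ∷ []

allWords : ℕ → List (List Step)
allWords zero    = [ [] ]
allWords (suc n) = concatMap (λ s → map (s ∷_) (allWords n)) allSteps

motzkinFrom : ℕ → List Step → Bool
motzkinFrom zero    []       = true
motzkinFrom (suc _) []       = false
motzkinFrom h       (U ∷ ws) = motzkinFrom (suc h) ws
motzkinFrom zero    (D ∷ ws) = false
motzkinFrom (suc h) (D ∷ ws) = motzkinFrom h ws
motzkinFrom h       (H ∷ ws) = motzkinFrom h ws

isMotzkin : List Step → Bool
isMotzkin = motzkinFrom 0

isWeakValley : Step → Step → Bool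
isWeakValley H H = true
isWeakValley H U = true
isWeakValley D H = true
isWeakValley D U = true
isWeakValley _ _ = false

weakValleys : List Step → ℕ
weakValleys (x ∷ y ∷ xs) = (if isWeakValley x y then 1 else 0) + weakValleys (y ∷ xs)
weakValleys _ = 0

numMotzkin : (n k : ℕ) → ℕ
numMotzkin n k =
  length (filterᵇ (λ p → isMotzkin p ∧ (weakValleys p ≡ᵇ k)) (allWords n))

module Submission where

-- For an involution π, an occurrence of 3412 is the same as two crossing arcs
-- x < y < π x < π y, so I_n(3412) consists of the noncrossing involutions.
-- Writing U at an opener i < π i, D at a closer and H at a fixed point gives a
-- bijection from noncrossing involutions to Motzkin words: every noncrossing
-- involution of a segment is the involution drawn by a plane tree (first-return
-- decomposition), whose word is its code, and every Motzkin word is a tree word.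
-- For a noncrossing involution an ascent at i means exactly that i is not an
-- opener and i + 1 is not a closer, i.e. a weak valley of the code at i.

open import Defs
open import Data.Bool using (Bool; true; false; T; not; _∧_; if_then_else_)
open import Data.Bool.Properties using (T-≡; T-∧)
open import Data.Bool.ListAction using (any)
open import Data.Nat using (ℕ; zero; suc; _+_; _<ᵇ_; _≡ᵇ_; _≤_; _<_; s≤s; z≤n; z<s)
open import Data.Nat.Properties
import Data.Fin as Fin
open import Data.Fin using (Fin; toℕ; fromℕ<)
open import Data.Fin.Properties using (toℕ-injective; toℕ<n; toℕ-fromℕ<) renaming (_≟_ to _≟ᶠ_)
open import Data.Vec using (Vec; lookup; toList; tabulate) renaming ([] to []ᵛ; _∷_ to _∷ᵛ_)
open import Data.Vec.Properties using (lookup∘tabulate; tabulate∘lookup; tabulate-cong)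
  renaming (∷-injective to ∷ᵛ-injective)
open import Data.List using (List; []; _∷_; map; concatMap; cartesianProductWith; allFin; length; filterᵇ; _++_; foldr)
open import Data.List.Properties using (∷-injective; ++-assoc; foldr-++; ++-identityʳ)
open import Data.List.Membership.Propositional using (_∈_; lose)
open import Data.List.Membership.Propositional.Properties
  using (∈-∃++; ∈-filter⁺; ∈-filter⁻; ∈-allFin; ∈-cartesianProductWith⁺; ∈-cartesianProductWith⁻)
open import Data.List.Relation.Unary.Any using (here; there; satisfied)
open import Data.List.Relation.Unary.Any.Properties using (any⁺; any⁻)
open import Data.List.Relation.Unary.All using ([]; _∷_) renaming (lookup to lookupAll; tabulate to tabulateAll)
open import Data.List.Relation.Unary.All.Properties using (all⁺; all⁻)
open import Data.List.Relation.Unary.AllPairs using ([]; _∷_)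
open import Data.List.Relation.Unary.Unique.Propositional using (Unique)
open import Data.List.Relation.Unary.Unique.Propositional.Properties
  using (allFin⁺; cartesianProductWith⁺) renaming (filter⁺ to unique-filter⁺)
open import Data.Product using (Σ; _×_; _,_; proj₁; proj₂)
open import Data.Sum using (_⊎_; inj₁; inj₂)
open import Data.Empty using (⊥; ⊥-elim)
open import Data.Unit using (tt)
open import Function using (_∘_)
open import Function.Bundles using (Equivalence)
open import Relation.Nullary using (¬_; yes; no)
open import Relation.Nullary.Decidable using (T?; ⌊_⌋; toWitness; fromWitness)
open import Relation.Binary using (tri<; tri≈; tri>)
open import Relation.Binary.PropositionalEquality
  using (_≡_; _≢_; refl; sym; trans; cong; cong₂; subst; subst₂; module ≡-Reasoning)

∈-skip : {B : Set} {y z : B} (ys₁ ys₂ : List B) → y ∈ ys₁ ++ z ∷ ys₂ → y ≢ z → y ∈ ys₁ ++ ys₂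
∈-skip []        ys₂ (here y≡z) y≢z = ⊥-elim (y≢z y≡z)
∈-skip []        ys₂ (there m)  y≢z = m
∈-skip (a ∷ ys₁) ys₂ (here y≡a) y≢z = here y≡a
∈-skip (a ∷ ys₁) ys₂ (there m)  y≢z = there (∈-skip ys₁ ys₂ m y≢z)

length-skip : {B : Set} (ys₁ ys₂ : List B) (z : B) → length (ys₁ ++ z ∷ ys₂) ≡ suc (length (ys₁ ++ ys₂))
length-skip []        ys₂ z = refl
length-skip (a ∷ ys₁) ys₂ z = cong suc (length-skip ys₁ ys₂ z)

injection-length≤ : {A B : Set} (h : A → B) (xs : List A) (ys : List B) → Unique xs →
  (∀ {x} → x ∈ xs → h x ∈ ys) →
  (∀ {x x′} → x ∈ xs → x′ ∈ xs → h x ≡ h x′ → x ≡ x′) → length xs ≤ length ys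
injection-length≤ h []       ys u into inj = z≤n
injection-length≤ h (x ∷ xs) ys (x∉xs ∷ u) into inj with ∈-∃++ (into (here refl))
... | ys₁ , ys₂ , refl =
  subst (suc (length xs) ≤_) (sym (length-skip ys₁ ys₂ (h x)))
    (s≤s (injection-length≤ h xs (ys₁ ++ ys₂) u into′ (λ m m′ → inj (there m) (there m′))))
  where
  into′ : ∀ {x′} → x′ ∈ xs → h x′ ∈ ys₁ ++ ys₂
  into′ m = ∈-skip ys₁ ys₂ (into (there m)) (λ e → lookupAll x∉xs m (inj (here refl) (there m) (sym e)))

RetractOn : {A B : Set} (P : A → Bool) (Q : B → Bool) (as : List A) (bs : List B) (f : A → B) (g : B → A) → Set
RetractOn P Q as bs f g = ∀ a → a ∈ as → T (P a) → T (Q (f a)) × f a ∈ bs × g (f a) ≡ a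

filter-length≤ : {A B : Set} (P : A → Bool) (Q : B → Bool) (as : List A) (bs : List B) (f : A → B) (g : B → A) →
  Unique as → RetractOn P Q as bs f g → length (filterᵇ P as) ≤ length (filterᵇ Q bs)
filter-length≤ P Q as bs f g ua retract =
  injection-length≤ f (filterᵇ P as) (filterᵇ Q bs) (unique-filter⁺ (T? ∘ P) ua) into inj
  where
  member : ∀ {a} → a ∈ filterᵇ P as → a ∈ as × T (P a)
  member = ∈-filter⁻ (T? ∘ P)
  into : ∀ {a} → a ∈ filterᵇ P as → f a ∈ filterᵇ Q bs
  into {a} m with member m
  ... | m₁ , p with retract a m₁ p
  ...   | q , fa∈bs , _ = ∈-filter⁺ (T? ∘ Q) fa∈bs q
  inverse : ∀ {a} → a ∈ filterᵇ P as → g (f a) ≡ a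
  inverse {a} m = proj₂ (proj₂ (retract a (proj₁ (member m)) (proj₂ (member m))))
  inj : ∀ {a a′} → a ∈ filterᵇ P as → a′ ∈ filterᵇ P as → f a ≡ f a′ → a ≡ a′
  inj m m′ e = trans (sym (inverse m)) (trans (cong g e) (inverse m′))

filter-length≡ : {A B : Set} (P : A → Bool) (Q : B → Bool) (as : List A) (bs : List B) (f : A → B) (g : B → A) →
  Unique as → Unique bs → RetractOn P Q as bs f g → RetractOn Q P bs as g f →
  length (filterᵇ P as) ≡ length (filterᵇ Q bs)
filter-length≡ P Q as bs f g ua ub fg gf =
  ≤-antisym (filter-length≤ P Q as bs f g ua fg) (filter-length≤ Q P bs as g f ub gf)

concatMap≡cartesianProduct : {X C D : Set} (f : X → C → D) (xs : List X) (ys : List C) →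
  concatMap (λ x → map (f x) ys) xs ≡ cartesianProductWith f xs ys
concatMap≡cartesianProduct f []       ys = refl
concatMap≡cartesianProduct f (x ∷ xs) ys = cong (map (f x) ys ++_) (concatMap≡cartesianProduct f xs ys)

allVecs-unique : ∀ n m → Unique (allVecs n m)
allVecs-unique zero    m = [] ∷ []
allVecs-unique (suc n) m =
  subst Unique (sym (concatMap≡cartesianProduct _∷ᵛ_ (allFin m) (allVecs n m)))
    (cartesianProductWith⁺ _∷ᵛ_ ∷ᵛ-injective (allFin⁺ m) (allVecs-unique n m))

allVecs-complete : ∀ n m (v : Vec (Fin m) n) → v ∈ allVecs n m
allVecs-complete zero    m []ᵛ       = here refl
allVecs-complete (suc n) m (x ∷ᵛ v) =
  subst (x ∷ᵛ v ∈_) (sym (concatMap≡cartesianProduct _∷ᵛ_ (allFin m) (allVecs n m)))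
    (∈-cartesianProductWith⁺ _∷ᵛ_ (∈-allFin x) (allVecs-complete n m v))

allSteps-unique : Unique allSteps
allSteps-unique = ((λ ()) ∷ (λ ()) ∷ []) ∷ ((λ ()) ∷ []) ∷ [] ∷ []

allSteps-complete : ∀ s → s ∈ allSteps
allSteps-complete U = here refl
allSteps-complete D = there (here refl)
allSteps-complete H = there (there (here refl))

allWords≡product : ∀ n → allWords (suc n) ≡ cartesianProductWith _∷_ allSteps (allWords n)
allWords≡product n = concatMap≡cartesianProduct _∷_ allSteps (allWords n)

allWords-unique : ∀ n → Unique (allWords n)
allWords-unique zero    = [] ∷ []
allWords-unique (suc n) =
  subst Unique (sym (allWords≡product n))
    (cartesianProductWith⁺ _∷_ ∷-injective allSteps-unique (allWords-unique n))

allWords-complete : ∀ (p : List Step) → p ∈ allWords (length p)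
allWords-complete []      = here refl
allWords-complete (s ∷ p) =
  subst (s ∷ p ∈_) (sym (allWords≡product (length p)))
    (∈-cartesianProductWith⁺ _∷_ (allSteps-complete s) (allWords-complete p))

allWords-length : ∀ n {p} → p ∈ allWords n → length p ≡ n
allWords-length zero    (here refl) = refl
allWords-length (suc n) m
  with _ , q , _ , q∈ , refl ← ∈-cartesianProductWith⁻ _∷_ allSteps (allWords n) (subst (_ ∈_) (allWords≡product n) m)
  = cong suc (allWords-length n q∈)

¬T⇒≡false : ∀ {b} → ¬ T b → b ≡ false
¬T⇒≡false {false} _  = refl
¬T⇒≡false {true}  ¬t = ⊥-elim (¬t tt)

≡ᵇ-true : ∀ {m n} → m ≡ n → (m ≡ᵇ n) ≡ true
≡ᵇ-true {m} refl = Equivalence.to T-≡ (≡⇒≡ᵇ m m refl)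

≡ᵇ-false : ∀ {m n} → m ≢ n → (m ≡ᵇ n) ≡ false
≡ᵇ-false {m} {n} m≢n = ¬T⇒≡false (m≢n ∘ ≡ᵇ⇒≡ m n)

<ᵇ-true : ∀ {m n} → m < n → (m <ᵇ n) ≡ true
<ᵇ-true m<n = Equivalence.to T-≡ (<⇒<ᵇ m<n)

<ᵇ-false : ∀ {m n} → ¬ m < n → (m <ᵇ n) ≡ false
<ᵇ-false {m} {n} m≮n = ¬T⇒≡false (m≮n ∘ <ᵇ⇒< m n)

T-ext : ∀ {b c} → (T b → T c) → (T c → T b) → b ≡ c
T-ext {false} {false} _ _ = refl
T-ext {false} {true}  _ g = ⊥-elim (g tt)
T-ext {true}  {false} f _ = ⊥-elim (f tt)
T-ext {true}  {true}  _ _ = refl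

not-T : ∀ {b} → T (not b) → ¬ T b
not-T {false} _ ()

T-not : ∀ {b} → ¬ T b → T (not b)
T-not {false} _   = tt
T-not {true}  ¬tt = ¬tt tt

∧-intro : ∀ {b c} → T b → T c → T (b ∧ c)
∧-intro tb tc = Equivalence.from T-∧ (tb , tc)

<-≡ : ∀ {x y z : ℕ} → x < y → y ≡ z → x < z
<-≡ x<y refl = x<y

Closed : (ℕ → ℕ) → ℕ → ℕ → Set
Closed π a n = ∀ i → a ≤ i → i < a + n → a ≤ π i × π i < a + n

Involutive : (ℕ → ℕ) → ℕ → ℕ → Set
Involutive π a n = ∀ i → a ≤ i → i < a + n → π (π i) ≡ i

Noncrossing : (ℕ → ℕ) → ℕ → ℕ → Set
Noncrossing π a n = ∀ x y → a ≤ x → x < y → y < a + n → y < π x → π x < π y → ⊥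

involutive-sub : ∀ {π a n a′ n′} → Involutive π a n → a ≤ a′ → a′ + n′ ≤ a + n → Involutive π a′ n′
involutive-sub inv a≤a′ end≤ i l₁ l₂ = inv i (≤-trans a≤a′ l₁) (<-≤-trans l₂ end≤)

noncrossing-sub : ∀ {π a n a′ n′} → Noncrossing π a n → a ≤ a′ → a′ + n′ ≤ a + n → Noncrossing π a′ n′
noncrossing-sub nc a≤a′ end≤ x y l₁ l₂ l₃ = nc x y (≤-trans a≤a′ l₁) l₂ (<-≤-trans l₃ end≤)

stepOf : ℕ → ℕ → Step
stepOf i v = if v <ᵇ i then D else if i <ᵇ v then U else H

stepOf-H : ∀ i → stepOf i i ≡ H
stepOf-H i rewrite <ᵇ-false (<-irrefl (refl {x = i})) = refl

stepOf-U : ∀ i v → i < v → stepOf i v ≡ U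
stepOf-U i v i<v rewrite <ᵇ-false (<-asym i<v) | <ᵇ-true i<v = refl

stepOf-D : ∀ i v → v < i → stepOf i v ≡ D
stepOf-D i v v<i rewrite <ᵇ-true v<i = refl

code : (ℕ → ℕ) → ℕ → ℕ → List Step
code π a zero    = []
code π a (suc n) = stepOf a (π a) ∷ code π (suc a) n

code-length : ∀ π a n → length (code π a n) ≡ n
code-length π a zero    = refl
code-length π a (suc n) = cong suc (code-length π (suc a) n)

code-cong : ∀ π σ a n → (∀ i → a ≤ i → i < a + n → π i ≡ σ i) → code π a n ≡ code σ a n
code-cong π σ a zero    e = refl
code-cong π σ a (suc n) e =
  cong₂ _∷_ (cong (stepOf a) (e a ≤-refl (m<m+n a z<s)))
    (code-cong π σ (suc a) n (λ i l₁ l₂ → e i (<⇒≤ l₁) (<-≡ l₂ (sym (+-suc a n)))))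

code-++ : ∀ π a x y → code π a (x + y) ≡ code π a x ++ code π (a + x) y
code-++ π a zero    y rewrite +-identityʳ a = refl
code-++ π a (suc x) y rewrite code-++ π (suc a) x y | +-suc a x = refl

-- A Motzkin word is either empty, H followed by a Motzkin word, or
-- U w D w′ with Motzkin words w, w′ (first-return decomposition).
data Tree : Set where
  leaf  : Tree
  fixed : Tree → Tree
  arc   : Tree → Tree → Tree

size : Tree → ℕ
size leaf      = 0
size (fixed t) = suc (size t)
size (arc s t) = suc (size s + suc (size t))

word : Tree → List Step
word leaf      = []
word (fixed t) = H ∷ word t
word (arc s t) = U ∷ word s ++ D ∷ word t

-- treeInv t a is the involution drawn by t on the segment [a, a + size t):
-- `fixed` fixes a, `arc s t` swaps a with the closing point a + 1 + size s,
-- draws s strictly inside this arc and t after it.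
treeInv : Tree → ℕ → ℕ → ℕ
treeInv leaf      a i = i
treeInv (fixed t) a i = if i ≡ᵇ a then a else treeInv t (suc a) i
treeInv (arc s t) a i =
  if i ≡ᵇ a then a + suc (size s)
  else if i ≡ᵇ a + suc (size s) then a
  else if i <ᵇ a + suc (size s) then treeInv s (suc a) i
  else treeInv t (suc (a + suc (size s))) i

treeInv-fixed₀ : ∀ t a → treeInv (fixed t) a a ≡ a
treeInv-fixed₀ t a rewrite ≡ᵇ-true (refl {x = a}) = refl

treeInv-fixed₁ : ∀ t a i → a < i → treeInv (fixed t) a i ≡ treeInv t (suc a) i
treeInv-fixed₁ t a i a<i rewrite ≡ᵇ-false (λ e → <-irrefl (sym e) a<i) = refl

treeInv-open : ∀ s t a → treeInv (arc s t) a a ≡ a + suc (size s)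
treeInv-open s t a rewrite ≡ᵇ-true (refl {x = a}) = refl

treeInv-close : ∀ s t a → treeInv (arc s t) a (a + suc (size s)) ≡ a
treeInv-close s t a
  rewrite ≡ᵇ-false {a + suc (size s)} {a} (λ e → <-irrefl (sym e) (m<m+n a z<s))
        | ≡ᵇ-true (refl {x = a + suc (size s)}) = refl

treeInv-inside : ∀ s t a i → a < i → i < a + suc (size s) → treeInv (arc s t) a i ≡ treeInv s (suc a) i
treeInv-inside s t a i a<i i<m
  rewrite ≡ᵇ-false (λ e → <-irrefl (sym e) a<i) | ≡ᵇ-false (λ e → <-irrefl e i<m) | <ᵇ-true i<m = refl

treeInv-after : ∀ s t a i → a + suc (size s) < i → treeInv (arc s t) a i ≡ treeInv t (suc (a + suc (size s))) i
treeInv-after s t a i m<i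
  rewrite ≡ᵇ-false {i} {a} (λ e → <-irrefl (sym e) (<-trans (m<m+n a z<s) m<i))
        | ≡ᵇ-false (λ e → <-irrefl (sym e) m<i) | <ᵇ-false (<-asym m<i) = refl

end-fixed : ∀ a t → a + size (fixed t) ≡ suc a + size t
end-fixed a t = +-suc a (size t)

end-arc : ∀ a s t → a + size (arc s t) ≡ suc (a + suc (size s)) + size t
end-arc a s t = trans (sym (+-assoc a (suc (size s)) (suc (size t)))) (+-suc (a + suc (size s)) (size t))

end-inside : ∀ a s → suc a + size s ≡ a + suc (size s)
end-inside a s = sym (+-suc a (size s))

empty-segment : ∀ {a i} → a ≤ i → i < a + 0 → ⊥
empty-segment {a} l₁ l₂ = <-irrefl refl (<-≤-trans (<-≡ l₂ (+-identityʳ a)) l₁)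

region-fixed : ∀ a t i → a ≤ i → i < a + size (fixed t) → (i ≡ a) ⊎ (suc a ≤ i × i < suc a + size t)
region-fixed a t i l₁ l₂ with m≤n⇒m<n∨m≡n l₁
... | inj₂ e  = inj₁ (sym e)
... | inj₁ lt = inj₂ (lt , <-≡ l₂ (end-fixed a t))

data ArcRegion (a m e i : ℕ) : Set where
  opener  : i ≡ a → ArcRegion a m e i
  inside  : a < i → i < m → ArcRegion a m e i
  closer  : i ≡ m → ArcRegion a m e i
  after   : m < i → i < e → ArcRegion a m e i

region-arc : ∀ a s t i → a ≤ i → i < a + size (arc s t) →
  ArcRegion a (a + suc (size s)) (suc (a + suc (size s)) + size t) i
region-arc a s t i l₁ l₂ with m≤n⇒m<n∨m≡n l₁
... | inj₂ e  = opener (sym e)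
... | inj₁ lt with <-cmp i (a + suc (size s))
...   | tri< x _ _ = inside lt x
...   | tri≈ _ x _ = closer x
...   | tri> _ _ x = after x (<-≡ l₂ (end-arc a s t))

treeInv-closed : ∀ t a → Closed (treeInv t a) a (size t)
treeInv-closed leaf a i l₁ l₂ = ⊥-elim (empty-segment l₁ l₂)
treeInv-closed (fixed t) a i l₁ l₂ with region-fixed a t i l₁ l₂
... | inj₁ refl rewrite treeInv-fixed₀ t a = ≤-refl , l₂
... | inj₂ (p , q) rewrite treeInv-fixed₁ t a i p =
  let (u , v) = treeInv-closed t (suc a) i p q in <⇒≤ u , <-≡ v (sym (end-fixed a t))
treeInv-closed (arc s t) a i l₁ l₂ with region-arc a s t i l₁ l₂
... | opener refl rewrite treeInv-open s t a =
  m≤m+n a _ , <-≡ (s≤s (m≤m+n _ (size t))) (sym (end-arc a s t))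
... | inside p q rewrite treeInv-inside s t a i p q =
  let (u , v) = treeInv-closed s (suc a) i p (<-≡ q (sym (end-inside a s))) in
  <⇒≤ u , <-trans (<-≡ v (end-inside a s)) (<-≡ (s≤s (m≤m+n _ (size t))) (sym (end-arc a s t)))
... | closer refl rewrite treeInv-close s t a = ≤-refl , m<m+n a z<s
... | after p q rewrite treeInv-after s t a i p =
  let (u , v) = treeInv-closed t _ i p q in
  ≤-trans (m≤m+n a _) (<⇒≤ u) , <-≡ v (sym (end-arc a s t))

treeInv-involutive : ∀ t a → Involutive (treeInv t a) a (size t)
treeInv-involutive leaf a i l₁ l₂ = refl
treeInv-involutive (fixed t) a i l₁ l₂ with region-fixed a t i l₁ l₂
... | inj₁ refl rewrite treeInv-fixed₀ t a = treeInv-fixed₀ t a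
... | inj₂ (p , q) rewrite treeInv-fixed₁ t a i p =
  let (u , _) = treeInv-closed t (suc a) i p q in
  trans (treeInv-fixed₁ t a _ u) (treeInv-involutive t (suc a) i p q)
treeInv-involutive (arc s t) a i l₁ l₂ with region-arc a s t i l₁ l₂
... | opener refl rewrite treeInv-open s t a = treeInv-close s t a
... | inside p q rewrite treeInv-inside s t a i p q =
  let q′ = <-≡ q (sym (end-inside a s))
      (u , v) = treeInv-closed s (suc a) i p q′ in
  trans (treeInv-inside s t a _ u (<-≡ v (end-inside a s))) (treeInv-involutive s (suc a) i p q′)
... | closer refl rewrite treeInv-close s t a = treeInv-open s t a
... | after p q rewrite treeInv-after s t a i p =
  let (u , _) = treeInv-closed t _ i p q in
  trans (treeInv-after s t a _ u) (treeInv-involutive t _ i p q)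

treeInv-noncrossing : ∀ t a → Noncrossing (treeInv t a) a (size t)
treeInv-noncrossing leaf a x y l₁ l₂ l₃ l₄ l₅ = empty-segment (≤-trans l₁ (<⇒≤ l₂)) l₃
treeInv-noncrossing (fixed t) a x y l₁ l₂ l₃ l₄ l₅ with region-fixed a t x l₁ (<-trans l₂ l₃)
... | inj₁ refl rewrite treeInv-fixed₀ t a = <-asym l₂ l₄
... | inj₂ (p , q) rewrite treeInv-fixed₁ t a x p | treeInv-fixed₁ t a y (<-trans p l₂) =
  treeInv-noncrossing t (suc a) x y p l₂ (<-≡ l₃ (end-fixed a t)) l₄ l₅
treeInv-noncrossing (arc s t) a x y l₁ l₂ l₃ l₄ l₅ with region-arc a s t x l₁ (<-trans l₂ l₃)
... | opener refl rewrite treeInv-open s t a | treeInv-inside s t a y l₂ l₄ =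
  -- the inner tree stays strictly inside the arc
  <-irrefl refl (<-trans l₅ (<-≡ (proj₂ (treeInv-closed s (suc a) y l₂ (<-≡ l₄ (sym (end-inside a s)))))
                                (end-inside a s)))
... | inside p q rewrite treeInv-inside s t a x p q =
  let q′ = <-≡ q (sym (end-inside a s))
      (_ , v) = treeInv-closed s (suc a) x p q′
      y<m = <-trans l₄ (<-≡ v (end-inside a s)) in
  treeInv-noncrossing s (suc a) x y p l₂ (<-≡ y<m (sym (end-inside a s))) l₄
    (<-≡ l₅ (treeInv-inside s t a y (<-trans p l₂) y<m))
... | closer refl rewrite treeInv-close s t a = <-asym l₄ (<-trans (m<m+n a z<s) l₂)
... | after p q rewrite treeInv-after s t a x p | treeInv-after s t a y (<-trans p l₂) =
  treeInv-noncrossing t _ x y p l₂ (<-≡ l₃ (end-arc a s t)) l₄ l₅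

code-treeInv : ∀ t a → code (treeInv t a) a (size t) ≡ word t
code-treeInv leaf a = refl
code-treeInv (fixed t) a rewrite treeInv-fixed₀ t a | stepOf-H a =
  cong (H ∷_) (trans (code-cong _ _ (suc a) (size t) (λ i l₁ _ → treeInv-fixed₁ t a i l₁))
                     (code-treeInv t (suc a)))
code-treeInv (arc s t) a
  rewrite treeInv-open s t a | stepOf-U a (a + suc (size s)) (m<m+n a z<s)
        | code-++ (treeInv (arc s t) a) (suc a) (size s) (suc (size t)) | end-inside a s
        | treeInv-close s t a | stepOf-D (a + suc (size s)) a (m<m+n a z<s) =
  cong (U ∷_) (cong₂ _++_
    (trans (code-cong _ _ (suc a) (size s) (λ i l₁ l₂ → treeInv-inside s t a i l₁ (<-≡ l₂ (end-inside a s))))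
           (code-treeInv s (suc a)))
    (cong (D ∷_) (trans (code-cong _ _ (suc (a + suc (size s))) (size t) (λ i l₁ _ → treeInv-after s t a i l₁))
                        (code-treeInv t _))))

word-length : ∀ t → length (word t) ≡ size t
word-length t = trans (cong length (sym (code-treeInv t 0))) (code-length (treeInv t 0) 0 (size t))

TreeOf : (ℕ → ℕ) → ℕ → ℕ → Set
TreeOf π a n = Σ Tree λ t → size t ≡ n × code π a n ≡ word t × (∀ i → a ≤ i → i < a + n → treeInv t a i ≡ π i)

closed-after-fixed : ∀ {π a n} → π a ≡ a → Closed π a (suc n) → Involutive π a (suc n) → Closed π (suc a) n
closed-after-fixed {π} {a} {n} fix cl inv i l₁ l₂ =
  ≤∧≢⇒< a≤πi (λ a≡πi → <-irrefl (sym (i≡a a≡πi)) l₁) , <-≡ πi<end (+-suc a n)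
  where
  i<end : i < a + suc n
  i<end = <-≡ l₂ (sym (+-suc a n))
  a≤πi : a ≤ π i
  a≤πi = proj₁ (cl i (<⇒≤ l₁) i<end)
  πi<end : π i < a + suc n
  πi<end = proj₂ (cl i (<⇒≤ l₁) i<end)
  i≡a : a ≡ π i → i ≡ a
  i≡a a≡πi = trans (sym (inv i (<⇒≤ l₁) i<end)) (trans (cong π (sym a≡πi)) fix)

treeOf-fixed : ∀ {π a n} → π a ≡ a → TreeOf π (suc a) n → TreeOf π a (suc n)
treeOf-fixed {π} {a} fix (t , refl , code≡ , agrees) = fixed t , refl , code-fixed , agrees-fixed
  where
  code-fixed : code π a (suc (size t)) ≡ H ∷ word t
  code-fixed rewrite fix | stepOf-H a = cong (H ∷_) code≡
  agrees-fixed : ∀ i → a ≤ i → i < a + suc (size t) → treeInv (fixed t) a i ≡ π i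
  agrees-fixed i l₁ l₂ with m≤n⇒m<n∨m≡n l₁
  ... | inj₂ refl = trans (treeInv-fixed₀ t a) (sym fix)
  ... | inj₁ a<i  = trans (treeInv-fixed₁ t a i a<i) (agrees i a<i (<-≡ l₂ (+-suc a (size t))))

arc-split : ∀ {π a n} → Closed π a (suc n) → π a ≢ a → Σ ℕ λ p → Σ ℕ λ q → n ≡ p + suc q × π a ≡ a + suc p
arc-split {π} {a} {n} cl ¬fix with m≤n⇒∃[o]m+o≡n a<πa
  where a<πa = ≤∧≢⇒< (proj₁ (cl a ≤-refl (m<m+n a z<s))) (¬fix ∘ sym)
... | p , suc[a]+p≡πa with m≤n⇒∃[o]m+o≡n (≤-pred (+-cancelˡ-< a (suc p) (suc n) πa<end))
  where πa<end = subst (_< a + suc n) (trans (sym suc[a]+p≡πa) (sym (+-suc a p))) (proj₂ (cl a ≤-refl (m<m+n a z<s)))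
...   | q , suc[p]+q≡n = p , q , trans (sym suc[p]+q≡n) (sym (+-suc p q)) , trans (sym suc[a]+p≡πa) (sym (+-suc a p))

module ArcSplit {π : ℕ → ℕ} {a p q : ℕ}
  (cl : Closed π a (suc (p + suc q))) (inv : Involutive π a (suc (p + suc q)))
  (nc : Noncrossing π a (suc (p + suc q))) (opens : π a ≡ a + suc p) where

  m : ℕ
  m = a + suc p

  end≡ : a + suc (p + suc q) ≡ suc m + q
  end≡ = trans (sym (+-assoc a (suc p) (suc q))) (+-suc m q)

  m<end : m < a + suc (p + suc q)
  m<end = <-≡ (s≤s (m≤m+n m q)) (sym end≡)

  closes : π m ≡ a
  closes = trans (cong π (sym opens)) (inv a ≤-refl (m<m+n a z<s))

  -- Points strictly inside the arc are mapped inside: an image beyond m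
  -- would give an arc crossing a ↦ m.
  closed-inside : Closed π (suc a) p
  closed-inside i l₁ l₂ = ≤∧≢⇒< a≤πi (λ a≡πi → <-irrefl (i≡m a≡πi) i<m) , <-≡ πi<m (+-suc a p)
    where
    i<m : i < m
    i<m = <-≡ l₂ (sym (+-suc a p))
    i<end : i < a + suc (p + suc q)
    i<end = <-trans i<m m<end
    a≤πi : a ≤ π i
    a≤πi = proj₁ (cl i (<⇒≤ l₁) i<end)
    πi-inv : π (π i) ≡ i
    πi-inv = inv i (<⇒≤ l₁) i<end
    i≡m : a ≡ π i → i ≡ m
    i≡m a≡πi = trans (sym πi-inv) (trans (cong π (sym a≡πi)) opens)
    πi<m : π i < m
    πi<m with <-cmp (π i) m
    ... | tri< x _ _ = x
    ... | tri≈ _ x _ = ⊥-elim (<-irrefl (trans (sym closes) (trans (cong π (sym x)) πi-inv)) l₁)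
    ... | tri> _ _ x = ⊥-elim (nc a i ≤-refl l₁ i<end (<-≡ i<m (sym opens)) (subst (_< π i) (sym opens) x))

  -- Points after the arc are mapped after it, as π is a bijection on the inside.
  closed-after : Closed π (suc m) q
  closed-after i l₁ l₂ = m<πi , <-≡ (proj₂ (cl i a≤i i<end)) end≡
    where
    i<end : i < a + suc (p + suc q)
    i<end = <-≡ l₂ (sym end≡)
    a≤i : a ≤ i
    a≤i = ≤-trans (m≤m+n a (suc p)) (<⇒≤ l₁)
    πi-inv : π (π i) ≡ i
    πi-inv = inv i a≤i i<end
    m<πi : m < π i
    m<πi with <-cmp (π i) m
    ... | tri> _ _ x = x
    ... | tri≈ _ x _ = ⊥-elim (<-irrefl (sym (trans (sym πi-inv) (trans (cong π x) closes)))
                                        (<-≤-trans (m<m+n a z<s) (<⇒≤ l₁)))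
    ... | tri< x _ _ with m≤n⇒m<n∨m≡n (proj₁ (cl i a≤i i<end))
    ...   | inj₂ a≡πi = ⊥-elim (<-irrefl (sym (trans (sym πi-inv) (trans (cong π (sym a≡πi)) opens))) l₁)
    ...   | inj₁ a<πi =
      -- otherwise i = π (π i) would lie inside the arc
      ⊥-elim (<-asym (<-≡ (proj₂ (closed-inside (π i) a<πi (<-≡ x (+-suc a p)))) (sym (+-suc a p)))
                     (subst (m <_) (sym πi-inv) l₁))

  inside-bounds : suc a + p ≤ a + suc (p + suc q)
  inside-bounds = ≤-trans (≤-reflexive (sym (+-suc a p))) (<⇒≤ m<end)

  after-start : a ≤ suc m
  after-start = ≤-trans (m≤m+n a (suc p)) (n≤1+n m)

  treeOf-arc : TreeOf π (suc a) p → TreeOf π (suc m) q → TreeOf π a (suc (p + suc q))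
  treeOf-arc (s , refl , code-s , agrees-s) (t , refl , code-t , agrees-t) = arc s t , refl , code-arc , agrees-arc
    where
    code-arc : code π a (suc (size s + suc (size t))) ≡ word (arc s t)
    code-arc rewrite code-++ π (suc a) (size s) (suc (size t)) | sym (+-suc a (size s)) | opens | closes
                   | stepOf-U a (a + suc (size s)) (m<m+n a z<s) | stepOf-D (a + suc (size s)) a (m<m+n a z<s) =
      cong (U ∷_) (cong₂ _++_ code-s (cong (D ∷_) code-t))
    agrees-arc : ∀ i → a ≤ i → i < a + suc (size s + suc (size t)) → treeInv (arc s t) a i ≡ π i
    agrees-arc i l₁ l₂ with region-arc a s t i l₁ l₂
    ... | opener refl = trans (treeInv-open s t a) (sym opens)
    ... | inside x y  = trans (treeInv-inside s t a i x y) (agrees-s i x (<-≡ y (+-suc a (size s))))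
    ... | closer refl = trans (treeInv-close s t a) (sym closes)
    ... | after x y   = trans (treeInv-after s t a i x) (agrees-t i x y)

-- The structure theorem, by induction on the length n (bounded by the fuel k).
toTree : ∀ k n a π → n ≤ k → Closed π a n → Involutive π a n → Noncrossing π a n → TreeOf π a n
toTree k zero a π _ _ _ _ = leaf , refl , refl , λ i l₁ l₂ → ⊥-elim (empty-segment l₁ l₂)
toTree (suc k) (suc n) a π (s≤s n≤k) cl inv nc with π a ≟ a
... | yes fix =
  treeOf-fixed fix (toTree k n (suc a) π n≤k (closed-after-fixed fix cl inv)
    (involutive-sub {π} inv (n≤1+n a) (≤-reflexive (sym (+-suc a n))))
    (noncrossing-sub {π} nc (n≤1+n a) (≤-reflexive (sym (+-suc a n)))))
... | no ¬fix with arc-split cl ¬fix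
...   | p , q , refl , opens =
  treeOf-arc
    (toTree k p (suc a) π (≤-trans (m≤m+n p (suc q)) n≤k) closed-inside
      (involutive-sub {π} inv (n≤1+n a) inside-bounds) (noncrossing-sub {π} nc (n≤1+n a) inside-bounds))
    (toTree k q (suc m) π (≤-trans (≤-trans (n≤1+n q) (m≤n+m (suc q) p)) n≤k) closed-after
      (involutive-sub {π} inv after-start (≤-reflexive (sym end≡))) (noncrossing-sub {π} nc after-start (≤-reflexive (sym end≡))))
  where open ArcSplit cl inv nc opens

motzkinFrom-word : ∀ t h r → motzkinFrom h (word t ++ r) ≡ motzkinFrom h r
motzkinFrom-word leaf      h       r = refl
motzkinFrom-word (fixed t) zero    r = motzkinFrom-word t zero r
motzkinFrom-word (fixed t) (suc h) r = motzkinFrom-word t (suc h) r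
motzkinFrom-word (arc s t) zero    r rewrite ++-assoc (word s) (D ∷ word t) r =
  trans (motzkinFrom-word s 1 (D ∷ word t ++ r)) (motzkinFrom-word t zero r)
motzkinFrom-word (arc s t) (suc h) r rewrite ++-assoc (word s) (D ∷ word t) r =
  trans (motzkinFrom-word s (suc (suc h)) (D ∷ word t ++ r)) (motzkinFrom-word t (suc h) r)

word-motzkin : ∀ t → isMotzkin (word t) ≡ true
word-motzkin t = trans (cong (motzkinFrom 0) (sym (++-identityʳ (word t)))) (motzkinFrom-word t 0 [])

-- motzkinFrom only inspects the height when the word is empty or starts with D.
motzkinFrom-U : ∀ h p → motzkinFrom h (U ∷ p) ≡ motzkinFrom (suc h) p
motzkinFrom-U zero    p = refl
motzkinFrom-U (suc h) p = refl

motzkinFrom-H : ∀ h p → motzkinFrom h (H ∷ p) ≡ motzkinFrom h p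
motzkinFrom-H zero    p = refl
motzkinFrom-H (suc h) p = refl

closingWord : List Tree → List Step
closingWord []       = []
closingWord (t ∷ ts) = D ∷ word t ++ closingWord ts

motzkinFrom-decompose : ∀ h p → motzkinFrom h p ≡ true →
  Σ Tree λ t → Σ (List Tree) λ ts → length ts ≡ h × p ≡ word t ++ closingWord ts
motzkinFrom-decompose zero    []      _ = leaf , [] , refl , refl
motzkinFrom-decompose (suc h) []      ()
motzkinFrom-decompose h       (U ∷ p) e with motzkinFrom-decompose (suc h) p (trans (sym (motzkinFrom-U h p)) e)
... | t₀ , t₁ ∷ ts , refl , refl =
  arc t₀ t₁ , ts , refl , cong (U ∷_) (sym (++-assoc (word t₀) (D ∷ word t₁) (closingWord ts)))
motzkinFrom-decompose zero    (D ∷ p) ()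
motzkinFrom-decompose (suc h) (D ∷ p) e with motzkinFrom-decompose h p e
... | t₀ , ts , refl , refl = leaf , t₀ ∷ ts , refl , refl
motzkinFrom-decompose h       (H ∷ p) e with motzkinFrom-decompose h p (trans (sym (motzkinFrom-H h p)) e)
... | t₀ , ts , refl , refl = fixed t₀ , ts , refl , refl

motzkin-tree : ∀ p → isMotzkin p ≡ true → Σ Tree λ t → word t ≡ p
motzkin-tree p e with motzkinFrom-decompose 0 p e
... | t , [] , refl , refl = t , sym (++-identityʳ (word t))

-- Parsing a word back into a tree, reading it from the right with a stack
-- of trees still waiting for their opening U.
ParseState : Set
ParseState = Tree × List Tree

parseStep : Step → ParseState → ParseState
parseStep H (c , stack)     = fixed c , stack
parseStep D (c , stack)     = leaf , c ∷ stack
parseStep U (c , [])        = arc c leaf , []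
parseStep U (c , t ∷ stack) = arc c t , stack

parse : List Step → Tree
parse p = proj₁ (foldr parseStep (leaf , []) p)

parse-word-from : ∀ t stack → foldr parseStep (leaf , stack) (word t) ≡ (t , stack)
parse-word-from leaf      stack = refl
parse-word-from (fixed t) stack rewrite parse-word-from t stack = refl
parse-word-from (arc s t) stack
  rewrite foldr-++ parseStep (leaf , stack) (word s) (D ∷ word t)
        | parse-word-from t stack | parse-word-from s (t ∷ stack) = refl

parse-word : ∀ t → parse (word t) ≡ t
parse-word t = cong proj₁ (parse-word-from t [])

-- A weak valley is a step that does not go up followed by one that does not go down.
notUp : Step → Bool
notUp U = false
notUp _ = true

notDown : Step → Bool
notDown D = false
notDown _ = true

weakValley-split : ∀ x y → isWeakValley x y ≡ notUp x ∧ notDown y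
weakValley-split U _ = refl
weakValley-split D U = refl
weakValley-split D D = refl
weakValley-split D H = refl
weakValley-split H U = refl
weakValley-split H D = refl
weakValley-split H H = refl

notUp-stepOf⁺ : ∀ i v → v ≤ i → T (notUp (stepOf i v))
notUp-stepOf⁺ i v v≤i with m≤n⇒m<n∨m≡n v≤i
... | inj₁ v<i rewrite stepOf-D i v v<i = tt
... | inj₂ refl rewrite stepOf-H v = tt

notUp-stepOf⁻ : ∀ i v → T (notUp (stepOf i v)) → v ≤ i
notUp-stepOf⁻ i v t with v ≤? i
... | yes v≤i = v≤i
... | no  v≰i = ⊥-elim (subst (T ∘ notUp) (stepOf-U i v (≰⇒> v≰i)) t)

notDown-stepOf⁺ : ∀ i v → i ≤ v → T (notDown (stepOf i v))
notDown-stepOf⁺ i v i≤v with m≤n⇒m<n∨m≡n i≤v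
... | inj₁ i<v rewrite stepOf-U i v i<v = tt
... | inj₂ refl rewrite stepOf-H i = tt

notDown-stepOf⁻ : ∀ i v → T (notDown (stepOf i v)) → i ≤ v
notDown-stepOf⁻ i v t with i ≤? v
... | yes i≤v = i≤v
... | no  i≰v = ⊥-elim (subst (T ∘ notDown) (stepOf-D i v (≰⇒> i≰v)) t)

module AscentAt {π : ℕ → ℕ} {n : ℕ}
  (cl : Closed π 0 n) (inv : Involutive π 0 n) (nc : Noncrossing π 0 n) (i : ℕ) (i+1<n : suc i < n) where

  i<n : i < n
  i<n = <-trans (n<1+n i) i+1<n

  -- At an ascent, i does not open an arc: otherwise the arcs at i and i + 1 cross.
  ascent⇒notOpener : π i < π (suc i) → π i ≤ i
  ascent⇒notOpener asc with π i ≤? i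
  ... | yes πi≤i = πi≤i
  ... | no  πi≰i = ⊥-elim (nc i (suc i) z≤n (n<1+n i) i+1<n i+1<πi asc)
    where
    i+1<πi : suc i < π i
    i+1<πi = ≤∧≢⇒< (≰⇒> πi≰i) λ i+1≡πi →
      <-asym (≰⇒> πi≰i) (subst (π i <_) (trans (cong π i+1≡πi) (inv i z≤n i<n)) asc)

  -- At an ascent, i + 1 does not close an arc: otherwise the arcs ending at i and i + 1 cross.
  ascent⇒notCloser : π i < π (suc i) → suc i ≤ π (suc i)
  ascent⇒notCloser asc with suc i ≤? π (suc i)
  ... | yes le = le
  ... | no  i+1≰ = ⊥-elim (nc (π i) (π (suc i)) z≤n asc (proj₂ (cl (suc i) z≤n i+1<n)) πi+1<ππi ππi<ππi+1)
    where
    πi+1≤i : π (suc i) ≤ i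
    πi+1≤i = ≤-pred (≰⇒> i+1≰)
    πi+1<i : π (suc i) < i
    πi+1<i = ≤∧≢⇒< πi+1≤i λ πi+1≡i →
      <-asym asc (subst (_< π i) (sym πi+1≡i) (subst (i <_) (trans (sym (inv (suc i) z≤n i+1<n)) (cong π πi+1≡i))
                                                           (n<1+n i)))
    πi+1<ππi : π (suc i) < π (π i)
    πi+1<ππi = subst (π (suc i) <_) (sym (inv i z≤n i<n)) πi+1<i
    ππi<ππi+1 : π (π i) < π (π (suc i))
    ππi<ππi+1 = subst₂ _<_ (sym (inv i z≤n i<n)) (sym (inv (suc i) z≤n i+1<n)) (n<1+n i)

  ascent⇔weakValley : (π i <ᵇ π (suc i)) ≡ isWeakValley (stepOf i (π i)) (stepOf (suc i) (π (suc i)))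
  ascent⇔weakValley rewrite weakValley-split (stepOf i (π i)) (stepOf (suc i) (π (suc i))) =
    T-ext (λ t → let asc = <ᵇ⇒< _ _ t in
                 ∧-intro (notUp-stepOf⁺ i (π i) (ascent⇒notOpener asc))
                         (notDown-stepOf⁺ (suc i) (π (suc i)) (ascent⇒notCloser asc)))
          (λ t → let (u , d) = Equivalence.to T-∧ t in
                 <⇒<ᵇ (≤-<-trans (notUp-stepOf⁻ i (π i) u)
                                 (<-≤-trans (n<1+n i) (notDown-stepOf⁻ (suc i) (π (suc i)) d))))

interval : ℕ → ℕ → List ℕ
interval a zero    = []
interval a (suc n) = a ∷ interval (suc a) n

ascents≡weakValleys : ∀ π a n →
  (∀ i → a ≤ i → suc i < a + n → (π i <ᵇ π (suc i)) ≡ isWeakValley (stepOf i (π i)) (stepOf (suc i) (π (suc i)))) →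
  ascentsList (map π (interval a n)) ≡ weakValleys (code π a n)
ascents≡weakValleys π a zero          local = refl
ascents≡weakValleys π a (suc zero)    local = refl
ascents≡weakValleys π a (suc (suc n)) local =
  cong₂ _+_ (cong (λ b → if b then 1 else 0) (local a ≤-refl a+1<end))
    (ascents≡weakValleys π (suc a) (suc n) (λ i l₁ l₂ → local i (<⇒≤ l₁) (<-≡ l₂ (sym (+-suc a (suc n))))))
  where
  a+1<end : suc a < a + suc (suc n)
  a+1<end = <-≡ (s≤s (s≤s (m≤m+n a n))) (sym (trans (+-suc a (suc n)) (cong suc (+-suc a n))))

-- w as a function on ℕ (0 outside the positions of w).
at : ∀ {m n} → Vec (Fin m) n → ℕ → ℕ
at []ᵛ       i       = 0
at (x ∷ᵛ w) zero    = toℕ x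
at (x ∷ᵛ w) (suc i) = at w i

at-lookup : ∀ {m n} (w : Vec (Fin m) n) (i : Fin n) → at w (toℕ i) ≡ toℕ (lookup w i)
at-lookup (x ∷ᵛ w) Fin.zero    = refl
at-lookup (x ∷ᵛ w) (Fin.suc i) = at-lookup w i

at-fromℕ< : ∀ {m n} (w : Vec (Fin m) n) i (i<n : i < n) → at w i ≡ toℕ (lookup w (fromℕ< i<n))
at-fromℕ< w i i<n = trans (cong (at w) (sym (toℕ-fromℕ< i<n))) (at-lookup w (fromℕ< i<n))

at-closed : ∀ {n} (w : Vec (Fin n) n) → Closed (at w) 0 n
at-closed w i _ i<n = z≤n , subst (_< _) (sym (at-fromℕ< w i i<n)) (toℕ<n _)

map-interval-suc : ∀ (f : ℕ → ℕ) a k → map f (interval (suc a) k) ≡ map (f ∘ suc) (interval a k)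
map-interval-suc f a zero    = refl
map-interval-suc f a (suc k) = cong (f (suc a) ∷_) (map-interval-suc f (suc a) k)

toList-at : ∀ {m n} (w : Vec (Fin m) n) → map toℕ (toList w) ≡ map (at w) (interval 0 n)
toList-at []ᵛ                = refl
toList-at {n = suc n} (x ∷ᵛ w) =
  cong (toℕ x ∷_) (trans (toList-at w) (sym (map-interval-suc (at (x ∷ᵛ w)) 0 n)))

isInvolution-sound : ∀ {n} (w : Vec (Fin n) n) → T (isInvolution w) → Involutive (at w) 0 n
isInvolution-sound {n} w t i _ i<n =
  begin
    at w (at w i)                          ≡⟨ cong (at w) (at-fromℕ< w i i<n) ⟩
    at w (toℕ (lookup w i′))               ≡⟨ at-lookup w (lookup w i′) ⟩
    toℕ (lookup w (lookup w i′))           ≡⟨ cong toℕ (toWitness (lookupAll (all⁺ _ (allFin n) t) (∈-allFin i′))) ⟩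
    toℕ i′                                 ≡⟨ toℕ-fromℕ< i<n ⟩
    i ∎
  where
  open ≡-Reasoning
  i′ : Fin n
  i′ = fromℕ< i<n

isInvolution-complete : ∀ {n} (w : Vec (Fin n) n) → Involutive (at w) 0 n → T (isInvolution w)
isInvolution-complete {n} w inv =
  all⁻ (λ i → ⌊ lookup w (lookup w i) ≟ᶠ i ⌋) {allFin n} (tabulateAll λ {i} _ → fromWitness (toℕ-injective (ww≡ i)))
  where
  ww≡ : ∀ i → toℕ (lookup w (lookup w i)) ≡ toℕ i
  ww≡ i = trans (sym (at-lookup w (lookup w i)))
                (trans (cong (at w) (sym (at-lookup w i))) (inv (toℕ i) z≤n (toℕ<n i)))

Pattern3412 : (ℕ → ℕ) → ℕ → Set
Pattern3412 π n = Σ ℕ λ i → Σ ℕ λ j → Σ ℕ λ k → Σ ℕ λ l →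
  i < j × j < k × k < l × l < n × π k < π l × π l < π i × π i < π j

anyWitness : ∀ {A : Set} (p : A → Bool) xs → T (any p xs) → Σ A (T ∘ p)
anyWitness p xs = satisfied ∘ any⁻ p xs

contains3412-sound : ∀ {n} (w : Vec (Fin n) n) → T (contains3412 w) → Pattern3412 (at w) n
contains3412-sound {n} w t
  with i , tᵢ ← anyWitness _ (allFin n) t
  with j , tⱼ ← anyWitness _ (allFin n) tᵢ
  with k , tₖ ← anyWitness _ (allFin n) tⱼ
  with l , tₗ ← anyWitness _ (allFin n) tₖ
  with c₁ , r₁ ← Equivalence.to T-∧ tₗ
  with c₂ , r₂ ← Equivalence.to T-∧ r₁
  with c₃ , r₃ ← Equivalence.to T-∧ r₂
  with c₄ , r₄ ← Equivalence.to T-∧ r₃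
  with c₅ , c₆ ← Equivalence.to T-∧ r₄
  = toℕ i , toℕ j , toℕ k , toℕ l , <ᵇ⇒< _ _ c₁ , <ᵇ⇒< _ _ c₂ , <ᵇ⇒< _ _ c₃ , toℕ<n l ,
    values k l c₄ , values l i c₅ , values i j c₆
  where
  values : ∀ x y → T (toℕ (lookup w x) <ᵇ toℕ (lookup w y)) → at w (toℕ x) < at w (toℕ y)
  values x y c rewrite at-lookup w x | at-lookup w y = <ᵇ⇒< _ _ c

contains3412-complete : ∀ {n} (w : Vec (Fin n) n) → Pattern3412 (at w) n → T (contains3412 w)
contains3412-complete {n} w (i , j , k , l , i<j , j<k , k<l , l<n , c₄ , c₅ , c₆) =
  pick (fromℕ< i<n) (pick (fromℕ< j<n) (pick (fromℕ< k<n) (pick (fromℕ< l<n)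
    (∧-intro (positions i<n j<n i<j) (∧-intro (positions j<n k<n j<k) (∧-intro (positions k<n l<n k<l)
      (∧-intro (values k<n l<n c₄) (∧-intro (values l<n i<n c₅) (values i<n j<n c₆)))))))))
  where
  k<n : k < n
  k<n = <-trans k<l l<n
  j<n : j < n
  j<n = <-trans j<k k<n
  i<n : i < n
  i<n = <-trans i<j j<n
  pick : ∀ {p : Fin n → Bool} x → T (p x) → T (any p (allFin n))
  pick x px = any⁺ _ (lose (∈-allFin x) px)
  positions : ∀ {x y} (x<n : x < n) (y<n : y < n) → x < y → T (toℕ (fromℕ< x<n) <ᵇ toℕ (fromℕ< y<n))
  positions x<n y<n x<y = <⇒<ᵇ (subst₂ _<_ (sym (toℕ-fromℕ< x<n)) (sym (toℕ-fromℕ< y<n)) x<y)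
  values : ∀ {x y} (x<n : x < n) (y<n : y < n) → at w x < at w y →
    T (toℕ (lookup w (fromℕ< x<n)) <ᵇ toℕ (lookup w (fromℕ< y<n)))
  values {x} {y} x<n y<n c = <⇒<ᵇ (subst₂ _<_ (at-fromℕ< w x x<n) (at-fromℕ< w y y<n) c)

NCInvolution : (ℕ → ℕ) → ℕ → Set
NCInvolution π n = Closed π 0 n × Involutive π 0 n × Noncrossing π 0 n

-- Crossing arcs x < y < π x < π y form the pattern 3412 at x, y, π x, π y.
avoids3412⇒noncrossing : ∀ π n → Closed π 0 n → Involutive π 0 n → ¬ Pattern3412 π n → Noncrossing π 0 n
avoids3412⇒noncrossing π n cl inv no3412 x y _ x<y y<n y<πx πx<πy =
  no3412 (x , y , π x , π y , x<y , y<πx , πx<πy , proj₂ (cl y z≤n y<n) ,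
          subst₂ _<_ (sym (inv x z≤n x<n)) (sym (inv y z≤n y<n)) x<y ,
          subst (_< π x) (sym (inv y z≤n y<n)) y<πx , πx<πy)
  where
  x<n : x < n
  x<n = <-trans x<y y<n

-- Conversely a 3412 at i < j < k < l gives crossing arcs: at i, j if j < π i,
-- at π k, π l if π l < k, and otherwise π l < π i ≤ j < k ≤ π l is absurd.
noncrossing⇒avoids3412 : ∀ π n → NCInvolution π n → ¬ Pattern3412 π n
noncrossing⇒avoids3412 π n (cl , inv , nc) (i , j , k , l , i<j , j<k , k<l , l<n , πk<πl , πl<πi , πi<πj)
  with j <? π i
... | yes j<πi = nc i j z≤n i<j (<-trans j<k (<-trans k<l l<n)) j<πi πi<πj
... | no  j≮πi with π l <? k
...   | yes πl<k = nc (π k) (π l) z≤n πk<πl (proj₂ (cl l z≤n l<n))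
                      (subst (π l <_) (sym (inv k z≤n k<n)) πl<k)
                      (subst₂ _<_ (sym (inv k z≤n k<n)) (sym (inv l z≤n l<n)) k<l)
    where
    k<n : k < n
    k<n = <-trans k<l l<n
...   | no  πl≮k = <-irrefl refl (≤-<-trans (≮⇒≥ πl≮k) (<-trans (<-≤-trans πl<πi (≮⇒≥ j≮πi)) j<k))

isNCInvolution-sound : ∀ {n} (w : Vec (Fin n) n) → T (isInvolution w) → T (not (contains3412 w)) →
  NCInvolution (at w) n
isNCInvolution-sound {n} w isInv avoids =
  at-closed w , inv , avoids3412⇒noncrossing (at w) n (at-closed w) inv (not-T avoids ∘ contains3412-complete w)
  where
  inv : Involutive (at w) 0 n
  inv = isInvolution-sound w isInv

isNCInvolution-complete : ∀ {n} (w : Vec (Fin n) n) → NCInvolution (at w) n →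
  T (isInvolution w) × T (not (contains3412 w))
isNCInvolution-complete {n} w ncInv@(_ , inv , _) =
  isInvolution-complete w inv , T-not (noncrossing⇒avoids3412 (at w) n ncInv ∘ contains3412-sound w)

ascents-code : ∀ {n} (w : Vec (Fin n) n) → NCInvolution (at w) n → ascents w ≡ weakValleys (code (at w) 0 n)
ascents-code {n} w (cl , inv , nc) =
  trans (cong ascentsList (toList-at w))
        (ascents≡weakValleys (at w) 0 n (λ i _ i+1<n → AscentAt.ascent⇔weakValley cl inv nc i i+1<n))

ncInvolution-cong : ∀ σ π n → (∀ i → i < n → σ i ≡ π i) → NCInvolution π n → NCInvolution σ n
ncInvolution-cong σ π n e (cl , inv , nc) = cl′ , inv′ , nc′
  where
  cl′ : Closed σ 0 n
  cl′ i l₁ l₂ rewrite e i l₂ = cl i l₁ l₂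
  inv′ : Involutive σ 0 n
  inv′ i l₁ l₂ rewrite e i l₂ = trans (e (π i) (proj₂ (cl i l₁ l₂))) (inv i l₁ l₂)
  nc′ : Noncrossing σ 0 n
  nc′ x y l₁ l₂ l₃ rewrite e x (<-trans l₂ l₃) | e y l₃ = nc x y l₁ l₂ l₃

toWord : ∀ {n} → Vec (Fin n) n → List Step
toWord {n} w = code (at w) 0 n

clamp : ∀ {n} → ℕ → Fin n → Fin n
clamp {n} v d with v <? n
... | yes v<n = fromℕ< v<n
... | no  _   = d

clamp-in-range : ∀ {n} v (d : Fin n) → v < n → toℕ (clamp v d) ≡ v
clamp-in-range {n} v d v<n with v <? n
... | yes v<n′ = toℕ-fromℕ< v<n′
... | no  v≮n  = ⊥-elim (v≮n v<n)

toVec : (n : ℕ) → List Step → Vec (Fin n) n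
toVec n p = tabulate (λ i → clamp (treeInv (parse p) 0 (toℕ i)) i)

at-toVec : ∀ n t i → i < n → treeInv t 0 i < n → at (toVec n (word t)) i ≡ treeInv t 0 i
at-toVec n t i i<n bound =
  begin
    at (toVec n (word t)) i                                    ≡⟨ at-fromℕ< (toVec n (word t)) i i<n ⟩
    toℕ (lookup (toVec n (word t)) (fromℕ< i<n))               ≡⟨ cong toℕ (lookup∘tabulate _ (fromℕ< i<n)) ⟩
    toℕ (clamp (treeInv (parse (word t)) 0 (toℕ (fromℕ< i<n))) _) ≡⟨ cong (λ s → toℕ (clamp (treeInv s 0 _) _)) (parse-word t) ⟩
    toℕ (clamp (treeInv t 0 (toℕ (fromℕ< i<n))) _)             ≡⟨ clamp-in-range _ _ (subst (λ j → treeInv t 0 j < n) (sym (toℕ-fromℕ< i<n)) bound) ⟩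
    treeInv t 0 (toℕ (fromℕ< i<n))                             ≡⟨ cong (treeInv t 0) (toℕ-fromℕ< i<n) ⟩
    treeInv t 0 i ∎
  where open ≡-Reasoning

toVec-toWord : ∀ {n} (w : Vec (Fin n) n) → NCInvolution (at w) n →
  Σ Tree λ t → toWord w ≡ word t × toVec n (toWord w) ≡ w
toVec-toWord {n} w (cl , inv , nc) with toTree n n 0 (at w) ≤-refl cl inv nc
... | t , _ , code≡ , agrees = t , code≡ , back
  where
  back : toVec n (toWord w) ≡ w
  back rewrite code≡ = trans (tabulate-cong entry) (tabulate∘lookup w)
    where
    entry : ∀ i → clamp (treeInv (parse (word t)) 0 (toℕ i)) i ≡ lookup w i
    entry i rewrite parse-word t = toℕ-injective
      (trans (clamp-in-range _ i (subst (_< n) (sym agrees-i) (proj₂ (at-closed w (toℕ i) z≤n (toℕ<n i)))))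
             (trans agrees-i (at-lookup w i)))
      where
      agrees-i : treeInv t 0 (toℕ i) ≡ at w (toℕ i)
      agrees-i = agrees (toℕ i) z≤n (toℕ<n i)

toWord-toVec : ∀ n t → size t ≡ n → NCInvolution (at (toVec n (word t))) n × toWord (toVec n (word t)) ≡ word t
toWord-toVec n t refl = ncInvolution-cong _ (treeInv t 0) n agrees tree-ncInv , code≡
  where
  bound : ∀ i → i < n → treeInv t 0 i < n
  bound i i<n = proj₂ (treeInv-closed t 0 i z≤n i<n)
  agrees : ∀ i → i < n → at (toVec n (word t)) i ≡ treeInv t 0 i
  agrees i i<n = at-toVec n t i i<n (bound i i<n)
  tree-ncInv : NCInvolution (treeInv t 0) n
  tree-ncInv = treeInv-closed t 0 , treeInv-involutive t 0 , treeInv-noncrossing t 0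
  code≡ : toWord (toVec n (word t)) ≡ word t
  code≡ = trans (code-cong _ (treeInv t 0) 0 n (λ i _ i<n → agrees i i<n)) (code-treeInv t 0)

counted3412 : ∀ {n} → ℕ → Vec (Fin n) n → Bool
counted3412 k w = isInvolution w ∧ not (contains3412 w) ∧ (ascents w ≡ᵇ k)

countedMotzkin : ℕ → List Step → Bool
countedMotzkin k p = isMotzkin p ∧ (weakValleys p ≡ᵇ k)

counted3412-split : ∀ {n} k (w : Vec (Fin n) n) → T (counted3412 k w) →
  T (isInvolution w) × T (not (contains3412 w)) × T (ascents w ≡ᵇ k)
counted3412-split k w counted =
  let (isInv , rest) = Equivalence.to (T-∧ {isInvolution w}) counted in
  isInv , Equivalence.to (T-∧ {not (contains3412 w)}) rest

countedMotzkin-split : ∀ k p → T (countedMotzkin k p) → T (isMotzkin p) × T (weakValleys p ≡ᵇ k)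
countedMotzkin-split k p = Equivalence.to (T-∧ {isMotzkin p})

toWord-retract : ∀ n k → RetractOn (counted3412 k) (countedMotzkin k) (allVecs n n) (allWords n) toWord (toVec n)
toWord-retract n k w _ counted = ∧-intro motzkin valleys≡k , member , back
  where
  isInv : T (isInvolution w)
  isInv = proj₁ (counted3412-split k w counted)
  avoids : T (not (contains3412 w))
  avoids = proj₁ (proj₂ (counted3412-split k w counted))
  ascents≡k : T (ascents w ≡ᵇ k)
  ascents≡k = proj₂ (proj₂ (counted3412-split k w counted))
  ncInv : NCInvolution (at w) n
  ncInv = isNCInvolution-sound w isInv avoids
  t : Tree
  t = proj₁ (toVec-toWord w ncInv)
  toWord≡ : toWord w ≡ word t
  toWord≡ = proj₁ (proj₂ (toVec-toWord w ncInv))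
  back : toVec n (toWord w) ≡ w
  back = proj₂ (proj₂ (toVec-toWord w ncInv))
  motzkin : T (isMotzkin (toWord w))
  motzkin = Equivalence.from T-≡ (trans (cong isMotzkin toWord≡) (word-motzkin t))
  valleys≡k : T (weakValleys (toWord w) ≡ᵇ k)
  valleys≡k = subst (λ m → T (m ≡ᵇ k)) (ascents-code w ncInv) ascents≡k
  member : toWord w ∈ allWords n
  member = subst (λ m → toWord w ∈ allWords m) (code-length (at w) 0 n) (allWords-complete (toWord w))

toVec-retract : ∀ n k → RetractOn (countedMotzkin k) (counted3412 k) (allWords n) (allVecs n n) (toVec n) toWord
toVec-retract n k p p∈ counted = subst Retracted word≡p (∧-intro isInv (∧-intro avoids ascents≡k) , member , toWord≡)
  where
  Retracted : List Step → Set
  Retracted q = T (counted3412 k (toVec n q)) × toVec n q ∈ allVecs n n × toWord (toVec n q) ≡ q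
  motzkin : T (isMotzkin p)
  motzkin = proj₁ (countedMotzkin-split k p counted)
  t : Tree
  t = proj₁ (motzkin-tree p (Equivalence.to T-≡ motzkin))
  word≡p : word t ≡ p
  word≡p = proj₂ (motzkin-tree p (Equivalence.to T-≡ motzkin))
  w : Vec (Fin n) n
  w = toVec n (word t)
  facts : NCInvolution (at w) n × toWord w ≡ word t
  facts = toWord-toVec n t (trans (sym (word-length t)) (trans (cong length word≡p) (allWords-length n p∈)))
  ncInv : NCInvolution (at w) n
  ncInv = proj₁ facts
  toWord≡ : toWord w ≡ word t
  toWord≡ = proj₂ facts
  isInv : T (isInvolution w)
  isInv = proj₁ (isNCInvolution-complete w ncInv)
  avoids : T (not (contains3412 w))
  avoids = proj₂ (isNCInvolution-complete w ncInv)
  ascents≡k : T (ascents w ≡ᵇ k)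
  ascents≡k = subst (λ m → T (m ≡ᵇ k))
    (sym (trans (ascents-code w ncInv) (trans (cong weakValleys toWord≡) (cong weakValleys word≡p))))
    (proj₂ (countedMotzkin-split k p counted))
  member : w ∈ allVecs n n
  member = allVecs-complete n n w

corollary3p3 : (n k : ℕ) → numInvolutions3412 n k ≡ numMotzkin n k
corollary3p3 n k =
  filter-length≡ (counted3412 k) (countedMotzkin k) (allVecs n n) (allWords n) toWord (toVec n)
    (allVecs-unique n n) (allWords-unique n) (toWord-retract n k) (toVec-retract n k)
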